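{- Let $G$ be a connected graph with root vertex $r$, and let $\phi$ be an atomic edge-coloring of $G$ that is a strong parity edge-coloring. Then $S_r$ is a linear subspace of $\mathbb{U}$, and for each $v\in V(G)$ the set $S_v$ is a coset of $S_r$ (in particular $|S_v|=|S_r|$).
   Context: $\mathbb{U}$ is the vector space over $\mathbb{F}_2$ of binary sequences with finitely many $1$s. An atom is a vector of $\mathbb{U}$ with exactly one coordinate equal to $1$; an atomic edge-coloring assigns an atom to each edge. For a walk $W$ with edges $e_1,\dots,e_t$ in order, $\phi(W)=\phi(e_1)+\cdots+\phi(e_t)$. For $v\in V(G)$, $S_v=\{\phi(W): W \text{ is a walk from } r \text{ to } v\}$. A walk is a parity walk if each color appears an even number of times along it (with multiplicity), and open if its endpoints are distinct; a strong parity edge-coloring is an edge-coloring with no open parity walk. -}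

module Defs where

open import Data.Nat using (ℕ; zero; suc; _≤_; _≟_)
open import Data.Nat.Properties using (≤-refl)
open import Data.Bool using (Bool; true; false; _xor_; T)
open import Data.Fin using (Fin)
open import Data.Product using (Σ; ∃; _×_; _,_; proj₁)
open import Relation.Nullary using (¬_; does)
import Relation.Nullary.Decidable
open import Relation.Binary.PropositionalEquality using (_≡_; _≢_)

FinitelySupported : (ℕ → Bool) → Set
FinitelySupported f = Σ ℕ λ N → ∀ i → N ≤ i → f i ≡ false

U : Set
U = Σ (ℕ → Bool) FinitelySupported

_≈U_ : U → U → Set
x ≈U y = ∀ i → proj₁ x i ≡ proj₁ y i

𝟎 : U
𝟎 = (λ _ → false) , (0 , λ _ _ → _≡_.refl)

xor-ff : ∀ {a b : Bool} → a ≡ false → b ≡ false → (a xor b) ≡ false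
xor-ff {false} {false} _ _ = _≡_.refl

max : ℕ → ℕ → ℕ
max zero n = n
max (suc m) zero = suc m
max (suc m) (suc n) = suc (max m n)

private
  m≤max : ∀ m n → m ≤ max m n
  m≤max zero n = Data.Nat.z≤n
  m≤max (suc m) zero = ≤-refl
  m≤max (suc m) (suc n) = Data.Nat.s≤s (m≤max m n)

  n≤max : ∀ m n → n ≤ max m n
  n≤max zero n = ≤-refl
  n≤max (suc m) zero = Data.Nat.z≤n
  n≤max (suc m) (suc n) = Data.Nat.s≤s (n≤max m n)

  ≤-tr : ∀ {a b c : ℕ} → a ≤ b → b ≤ c → a ≤ c
  ≤-tr = Data.Nat.Properties.≤-trans

_⊕_ : U → U → U
(f , M , pf) ⊕ (g , N , pg) =
  (λ i → f i xor g i) ,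
  (max M N , λ i le → xor-ff (pf i (≤-tr (m≤max M N) le)) (pg i (≤-tr (n≤max M N) le)))

atom : ℕ → U
atom k = (λ i → does (i ≟ k)) , (suc k , λ i le → lemma i le)
  where
  lemma : ∀ i → suc k ≤ i → does (i ≟ k) ≡ false
  lemma i le = Relation.Nullary.Decidable.dec-false (i ≟ k)
    (λ { _≡_.refl → Data.Nat.Properties.<-irrefl _≡_.refl le })

record Graph (n : ℕ) : Set where
  field
    adj     : Fin n → Fin n → Bool
    symm    : ∀ u v → adj u v ≡ adj v u
    irrefl  : ∀ v → adj v v ≡ false

module _ {n : ℕ} (G : Graph n) where
  open Graph G

  data Walk : Fin n → Fin n → Set where
    []  : ∀ {v} → Walk v v
    _∷_ : ∀ {u w v} → T (adj u w) → Walk w v → Walk u v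

  Connected : Set
  Connected = ∀ u v → Walk u v

-- An atomic edge-coloring: edge uv receives the atom e_(c u v); colors are
-- indexed by ℕ (color k ↔ atom e_k).  The function c is symmetric so that it
-- is a function of the (undirected) edge; its values on non-edges are irrelevant.
record AtomicEdgeColoring {n : ℕ} (G : Graph n) : Set where
  field
    c    : Fin n → Fin n → ℕ
    symm : ∀ u v → c u v ≡ c v u

module _ {n : ℕ} {G : Graph n} (φ : AtomicEdgeColoring G) where
  open AtomicEdgeColoring φ

  φW : ∀ {u v} → Walk G u v → U
  φW [] = 𝟎
  φW (_∷_ {u} {w} _ W) = atom (c u w) ⊕ φW W

  count : ℕ → ∀ {u v} → Walk G u v → ℕ
  count k [] = 0
  count k (_∷_ {u} {w} _ W) with c u w ≟ k
  ... | Relation.Nullary.yes _ = suc (count k W)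
  ... | Relation.Nullary.no _ = count k W

  Even : ℕ → Set
  Even m = Σ ℕ λ h → m ≡ h Data.Nat.+ h

  IsParityWalk : ∀ {u v} → Walk G u v → Set
  IsParityWalk W = ∀ k → Even (count k W)

  IsStrongParity : Set
  IsStrongParity = ∀ u v (W : Walk G u v) → u ≢ v → ¬ IsParityWalk W

  -- membership in S_v = { φ(W) : W a walk from r to v }
  -- S r v x  means  x ∈ S_v  (with root r)
  S : Fin n → Fin n → U → Set
  S r v x = Σ (Walk G r v) λ W → φW W ≈U x

IsSubspace : (U → Set) → Set
IsSubspace S = S 𝟎 × (∀ x y → S x → S y → S (x ⊕ y))

IsCosetOf : (U → Set) → (U → Set) → Set
IsCosetOf T S = Σ U λ a → ∀ x → (T x → Σ U λ s → S s × (x ≈U (a ⊕ s)))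
                              × ((Σ U λ s → S s × (x ≈U (a ⊕ s))) → T x)

-- Concatenation of walks adds their colour sums and reversal preserves them,
-- since every colour is its own inverse in 𝕌.  Hence S_r contains 0 (the
-- empty walk) and is closed under addition (concatenation of closed walks),
-- and for any fixed walk P from r to v, a walk W from r to v gives
-- φ(W) = φ(P) + φ(W P⁻¹), while a closed walk C at r gives φ(C P) = φ(P) + φ(C):
-- so S_v = φ(P) + S_r.
module Submission where

open import Defs
open import Data.Nat using (ℕ)
open import Data.Fin using (Fin)
open import Data.Bool using (Bool; false; _xor_; T)
open import Data.Bool.Properties using (xor-assoc; xor-comm; xor-same; xor-identityʳ)
open import Data.Product using (Σ; _×_; _,_; proj₁)
open import Relation.Binary.PropositionalEquality
  using (_≡_; refl; sym; trans; cong; cong₂; subst; module ≡-Reasoning)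
open ≡-Reasoning

-- (x ⊕ y) at i computes to x at i xor y at i, so equalities in 𝕌 are proved
-- coordinatewise by reasoning in Bool.
_at_ : U → ℕ → Bool
x at i = proj₁ x i

xor-cancelˡ : ∀ a b → a xor (b xor a) ≡ b
xor-cancelˡ a b = begin
  a xor (b xor a)   ≡⟨ cong (a xor_) (xor-comm b a) ⟩
  a xor (a xor b)   ≡⟨ sym (xor-assoc a a b) ⟩
  (a xor a) xor b   ≡⟨ cong (_xor b) (xor-same a) ⟩
  b                 ∎

module _ {n : ℕ} {G : Graph n} (φ : AtomicEdgeColoring G) where
  open AtomicEdgeColoring φ

  _++_ : ∀ {u v w} → Walk G u v → Walk G v w → Walk G u w
  []      ++ W′ = W′
  (e ∷ W) ++ W′ = e ∷ (W ++ W′)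

  reverse : ∀ {u v} → Walk G u v → Walk G v u
  reverse []                = []
  reverse (_∷_ {u} {w} e W) = reverse W ++ (subst T (Graph.symm G u w) e ∷ [])

  φW-++ : ∀ {u v w} (W : Walk G u v) (W′ : Walk G v w) →
          φW φ (W ++ W′) ≈U (φW φ W ⊕ φW φ W′)
  φW-++ []                W′ i = refl
  φW-++ (_∷_ {u} {w} e W) W′ i = begin
    atom (c u w) at i xor φW φ (W ++ W′) at i
      ≡⟨ cong (atom (c u w) at i xor_) (φW-++ W W′ i) ⟩
    atom (c u w) at i xor (φW φ W at i xor φW φ W′ at i)
      ≡⟨ sym (xor-assoc (atom (c u w) at i) _ _) ⟩
    (atom (c u w) at i xor φW φ W at i) xor φW φ W′ at i
      ∎

  φW-reverse : ∀ {u v} (W : Walk G u v) → φW φ (reverse W) ≈U φW φ W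
  φW-reverse []                i = refl
  φW-reverse (_∷_ {u} {w} e W) i = begin
    φW φ (reverse W ++ (e′ ∷ [])) at i
      ≡⟨ φW-++ (reverse W) (e′ ∷ []) i ⟩
    φW φ (reverse W) at i xor (atom (c w u) at i xor false)
      ≡⟨ cong₂ _xor_ (φW-reverse W i) (xor-identityʳ _) ⟩
    φW φ W at i xor atom (c w u) at i
      ≡⟨ cong (λ k → φW φ W at i xor atom k at i) (symm w u) ⟩
    φW φ W at i xor atom (c u w) at i
      ≡⟨ xor-comm (φW φ W at i) _ ⟩
    atom (c u w) at i xor φW φ W at i
      ∎
    where e′ = subst T (Graph.symm G u w) e

  S-root-isSubspace : ∀ r → IsSubspace (S φ r r)
  S-root-isSubspace r =
    ([] , λ i → refl) ,
    λ x y (W , φW≈x) (W′ , φW′≈y) →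
      W ++ W′ , λ i → trans (φW-++ W W′ i) (cong₂ _xor_ (φW≈x i) (φW′≈y i))

  S-isCosetOf-S-root : ∀ {r v} → Walk G r v → IsCosetOf (S φ r v) (S φ r r)
  S-isCosetOf-S-root {r} {v} P = φW φ P , λ x → into x , onto x
    where
    into : ∀ x → S φ r v x → Σ U λ s → S φ r r s × (x ≈U (φW φ P ⊕ s))
    into x (W , φW≈x) = φW φ (W ++ reverse P) , (W ++ reverse P , λ i → refl) , λ i → begin
      x at i
        ≡⟨ sym (φW≈x i) ⟩
      φW φ W at i
        ≡⟨ sym (xor-cancelˡ (φW φ P at i) (φW φ W at i)) ⟩
      φW φ P at i xor (φW φ W at i xor φW φ P at i)
        ≡⟨ cong (λ b → φW φ P at i xor (φW φ W at i xor b)) (sym (φW-reverse P i)) ⟩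
      φW φ P at i xor (φW φ W at i xor φW φ (reverse P) at i)
        ≡⟨ cong (φW φ P at i xor_) (sym (φW-++ W (reverse P) i)) ⟩
      φW φ P at i xor φW φ (W ++ reverse P) at i
        ∎

    onto : ∀ x → (Σ U λ s → S φ r r s × (x ≈U (φW φ P ⊕ s))) → S φ r v x
    onto x (s , (C , φC≈s) , x≈P⊕s) = C ++ P , λ i → begin
      φW φ (C ++ P) at i            ≡⟨ φW-++ C P i ⟩
      φW φ C at i xor φW φ P at i   ≡⟨ cong (_xor φW φ P at i) (φC≈s i) ⟩
      s at i xor φW φ P at i        ≡⟨ xor-comm (s at i) _ ⟩
      φW φ P at i xor s at i        ≡⟨ sym (x≈P⊕s i) ⟩
      x at i                        ∎

lemma2p5 : ∀ {n : ℕ} (G : Graph n) (r : Fin n) (φ : AtomicEdgeColoring G)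
    → Connected G
    → IsStrongParity φ
    → IsSubspace (S φ r r)
      × (∀ v → IsCosetOf (S φ r v) (S φ r r))
lemma2p5 G r φ connected _ =
  S-root-isSubspace φ r , λ v → S-isCosetOf-S-root φ (connected r v)
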